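{- Let $G$ be a graph with $n$ vertices. Then $\operatorname{avd}(G) \le n - \frac{2\nu(G)}{3}$.
   Context: Graphs are finite and simple. $\nu(G)$ is the matching number of $G$ (the maximum number of edges in a matching). A set $S \subseteq V(G)$ is a dominating set if every vertex is in $S$ or adjacent to a vertex of $S$; $\mathcal{D}(G)$ is the collection of dominating sets and $\operatorname{avd}(G) = \frac{1}{|\mathcal{D}(G)|}\sum_{S \in \mathcal{D}(G)} |S|$. -}

module Defs where

open import Data.Nat using (ℕ; zero; suc; _+_; _*_; _≤_)
open import Data.Bool using (Bool; true; false; _∧_; _∨_; if_then_else_)
open import Data.Fin using (Fin)
open import Data.Fin.Subset using (Subset; ∣_∣)
open import Data.Vec using (Vec; []; _∷_; lookup)
open import Data.List using (List; []; _∷_; [_]; map; _++_; length; filterᵇ; allFin; concatMap)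
open import Data.Bool.ListAction using (all; any)
open import Data.Nat.ListAction using (sum)
open import Data.List.Relation.Unary.All using (All)
open import Data.List.Relation.Unary.Unique.Propositional using (Unique)
open import Data.Product using (_×_; _,_; Σ; proj₁; proj₂)
open import Relation.Binary.PropositionalEquality using (_≡_)
open import Relation.Nullary using (¬_)

record Graph (n : ℕ) : Set where
  field
    adj    : Fin n → Fin n → Bool
    sym    : ∀ u v → adj u v ≡ adj v u
    irrefl : ∀ v → adj v v ≡ false
open Graph public

allSubsets : (n : ℕ) → List (Subset n)
allSubsets zero    = [ [] ]
allSubsets (suc n) = map (true ∷_) (allSubsets n) ++ map (false ∷_) (allSubsets n)

isDominating : ∀ {n} → Graph n → Subset n → Bool
isDominating {n} G S =
  all (λ v → lookup S v ∨ any (λ u → lookup S u ∧ adj G u v) (allFin n)) (allFin n)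

dominatingSets : ∀ {n} → Graph n → List (Subset n)
dominatingSets {n} G = filterᵇ (isDominating G) (allSubsets n)

totalDomSize : ∀ {n} → Graph n → ℕ
totalDomSize G = sum (map ∣_∣ (dominatingSets G))

numDom : ∀ {n} → Graph n → ℕ
numDom G = length (dominatingSets G)

endpoints : ∀ {n} → List (Fin n × Fin n) → List (Fin n)
endpoints = concatMap (λ e → proj₁ e ∷ proj₂ e ∷ [])

IsMatching : ∀ {n} → Graph n → List (Fin n × Fin n) → Set
IsMatching G M = All (λ e → adj G (proj₁ e) (proj₂ e) ≡ true) M × Unique (endpoints M)

IsMatchingNumber : ∀ {n} → Graph n → ℕ → Set
IsMatchingNumber G k =
  Σ (List _) (λ M → IsMatching G M × length M ≡ k) ×
  (∀ M → IsMatching G M → length M ≤ k)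

module Submission where

-- As |S| + |V∖S| = n it suffices that Σ_{S∈𝒟} 2|M| ≤ 3·Σ_{S∈𝒟} |V∖S| for a
-- maximum matching M (matching-bound).  Each pair (S, uv ∈ M) gets a charge:
-- (1) Demand: a dominating S owes 2 units to uv.  They are there when u or v is
--     missing; if u, v ∈ S, then S − u still dominates or u has a private
--     neighbour (removable-or-private), and likewise for v.
-- (2) Exchange: S ↦ S − u injects the sets from which u is removable into the
--     dominating sets missing u but containing v (removable-injection), for
--     which the charge pays one extra unit.
-- (3) Distribution: the charge of S over M is at most 3|V∖S| (charging), since a
--     missing vertex x carries ≤ 2 units for the matching edge at x and ≤ 1 for
--     the edge at its anchor, the S-vertex having x as private neighbour.

open import Data.Nat using (ℕ; zero; suc; _+_; _*_; _≤_; z≤n; s≤s)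
open import Data.Nat.Properties hiding (_≟_)
open import Data.Nat.ListAction using (sum)
open import Data.Nat.ListAction.Properties using (sum-++)
open import Data.Bool using (Bool; true; false; _∧_; _∨_; not)
import Data.Bool as Bool
open import Data.Bool.Properties using (∧-comm; ∧-conicalˡ; ∧-conicalʳ; ∨-conicalˡ; ∨-conicalʳ)
open import Data.Bool.ListAction using (all; any)
open import Data.Fin using (Fin; zero; suc; _≟_)
open import Data.Fin.Properties using (any?)
open import Data.Fin.Subset using (Subset; ∣_∣; ∁)
open import Data.Fin.Subset.Properties using (∣p∣≤n; ∣∁p∣≡n∸∣p∣)
open import Data.Vec using ([]; _∷_; lookup; _[_]≔_)
open import Data.Vec.Properties using (lookup-map; lookup∘update′; []≔-idempotent; []≔-lookup)
open import Data.List using (List; []; _∷_; map; _++_; length; filterᵇ; allFin)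
open import Data.List.Properties using (map-++; map-∘; map-tabulate)
open import Data.List.Membership.Propositional using (_∈_)
open import Data.List.Membership.Propositional.Properties using (∈-allFin)
open import Data.List.Relation.Unary.Any using (here; there)
open import Data.List.Relation.Unary.All using (All; []; _∷_)
open import Data.List.Relation.Unary.AllPairs using ([]; _∷_)
open import Data.List.Relation.Unary.Unique.Propositional using (Unique)
open import Relation.Nullary using (Dec; does; yes; no)
open import Relation.Nullary.Decidable using (dec-true; dec-false)
open import Data.Product using (_×_; _,_; proj₁; proj₂; ∃)
open import Data.Sum using (_⊎_; inj₁; inj₂)
open import Data.Empty using (⊥-elim)
open import Relation.Binary.PropositionalEquality
open import Function using (_∘_)
open import Data.Nat.Tactic.RingSolver using (solve-∀)
open import Algebra.Properties.CommutativeSemigroup +-commutativeSemigroup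
  using () renaming (interchange to +-interchange)
open import Algebra.Properties.CommutativeSemigroup *-commutativeSemigroup
  using () renaming (x∙yz≈y∙xz to *-left-comm)

open import Defs hiding (sym)

χ : Bool → ℕ
χ true  = 1
χ false = 0

∑ : {A : Set} → List A → (A → ℕ) → ℕ
∑ xs f = sum (map f xs)

module _ {A : Set} where

  ∑-cong : ∀ xs {f g : A → ℕ} → (∀ x → f x ≡ g x) → ∑ xs f ≡ ∑ xs g
  ∑-cong []       f≡g = refl
  ∑-cong (x ∷ xs) f≡g = cong₂ _+_ (f≡g x) (∑-cong xs f≡g)

  ∑-mono : ∀ xs {f g : A → ℕ} → (∀ x → f x ≤ g x) → ∑ xs f ≤ ∑ xs g
  ∑-mono []       f≤g = z≤n
  ∑-mono (x ∷ xs) f≤g = +-mono-≤ (f≤g x) (∑-mono xs f≤g)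

  ∑-mono-All : ∀ {P : A → Set} {xs} {f g : A → ℕ} → All P xs → (∀ x → P x → f x ≤ g x) → ∑ xs f ≤ ∑ xs g
  ∑-mono-All []         f≤g = z≤n
  ∑-mono-All (px ∷ pxs) f≤g = +-mono-≤ (f≤g _ px) (∑-mono-All pxs f≤g)

  ∑-+ : ∀ xs (f g : A → ℕ) → ∑ xs (λ x → f x + g x) ≡ ∑ xs f + ∑ xs g
  ∑-+ []       f g = refl
  ∑-+ (x ∷ xs) f g = begin
    f x + g x + ∑ xs (λ x → f x + g x) ≡⟨ cong (f x + g x +_) (∑-+ xs f g) ⟩
    f x + g x + (∑ xs f + ∑ xs g)      ≡⟨ +-interchange (f x) (g x) (∑ xs f) (∑ xs g) ⟩
    f x + ∑ xs f + (g x + ∑ xs g)      ∎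
    where open ≡-Reasoning

  ∑-*ˡ : ∀ xs k (f : A → ℕ) → ∑ xs (λ x → k * f x) ≡ k * ∑ xs f
  ∑-*ˡ []       k f = sym (*-zeroʳ k)
  ∑-*ˡ (x ∷ xs) k f = trans (cong (k * f x +_) (∑-*ˡ xs k f)) (sym (*-distribˡ-+ k (f x) (∑ xs f)))

  ∑-const : ∀ xs k → ∑ xs (λ (_ : A) → k) ≡ k * length xs
  ∑-const []       k = sym (*-zeroʳ k)
  ∑-const (x ∷ xs) k = trans (cong (k +_) (∑-const xs k)) (sym (*-suc k (length xs)))

  ∑-++ : ∀ xs ys (f : A → ℕ) → ∑ (xs ++ ys) f ≡ ∑ xs f + ∑ ys f
  ∑-++ xs ys f = trans (cong sum (map-++ f xs ys)) (sum-++ (map f xs) (map f ys))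

  ∑-weighted-+3 : ∀ xs (w f g h : A → ℕ) →
    ∑ xs (λ x → w x * (f x + g x + h x)) ≡
    ∑ xs (λ x → w x * f x) + ∑ xs (λ x → w x * g x) + ∑ xs (λ x → w x * h x)
  ∑-weighted-+3 xs w f g h = begin
    ∑ xs (λ x → w x * (f x + g x + h x))
      ≡⟨ ∑-cong xs distribute ⟩
    ∑ xs (λ x → w x * f x + w x * g x + w x * h x)
      ≡⟨ ∑-+ xs _ (λ x → w x * h x) ⟩
    ∑ xs (λ x → w x * f x + w x * g x) + ∑ xs (λ x → w x * h x)
      ≡⟨ cong (_+ ∑ xs (λ x → w x * h x)) (∑-+ xs (λ x → w x * f x) (λ x → w x * g x)) ⟩
    ∑ xs (λ x → w x * f x) + ∑ xs (λ x → w x * g x) + ∑ xs (λ x → w x * h x) ∎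
    where
    open ≡-Reasoning
    distribute : ∀ x → w x * (f x + g x + h x) ≡ w x * f x + w x * g x + w x * h x
    distribute x = trans (*-distribˡ-+ (w x) (f x + g x) (h x))
                         (cong (_+ w x * h x) (*-distribˡ-+ (w x) (f x) (g x)))

  ∑-filter : ∀ xs (p : A → Bool) (f : A → ℕ) → ∑ (filterᵇ p xs) f ≡ ∑ xs (λ x → χ (p x) * f x)
  ∑-filter []       p f = refl
  ∑-filter (x ∷ xs) p f with p x
  ... | true  = cong₂ _+_ (sym (+-identityʳ (f x))) (∑-filter xs p f)
  ... | false = ∑-filter xs p f

  ∈⇒≤∑ : ∀ {x xs} (f : A → ℕ) → x ∈ xs → f x ≤ ∑ xs f
  ∈⇒≤∑ f (here refl) = m≤m+n _ _
  ∈⇒≤∑ f (there x∈) = ≤-trans (∈⇒≤∑ f x∈) (m≤n+m _ _)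

∑-map : ∀ {A B : Set} xs (g : A → B) (f : B → ℕ) → ∑ (map g xs) f ≡ ∑ xs (f ∘ g)
∑-map xs g f = cong sum (sym (map-∘ xs))

∑-comm : ∀ {A B : Set} xs ys (f : A → B → ℕ) →
  ∑ xs (λ x → ∑ ys (f x)) ≡ ∑ ys (λ y → ∑ xs (λ x → f x y))
∑-comm []       ys f = sym (∑-const ys 0)
∑-comm (x ∷ xs) ys f = trans (cong (∑ ys (f x) +_) (∑-comm xs ys f))
                             (sym (∑-+ ys (f x) (λ y → ∑ xs (λ x → f x y))))

∑-allFin-suc : ∀ n (f : Fin (suc n) → ℕ) → ∑ (allFin (suc n)) f ≡ f zero + ∑ (allFin n) (f ∘ suc)
∑-allFin-suc n f = cong (λ xs → f zero + sum xs)
  (trans (map-tabulate suc f) (sym (map-tabulate (λ x → x) (f ∘ suc))))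

∣S∣≡∑ : ∀ {n} (S : Subset n) → ∣ S ∣ ≡ ∑ (allFin n) (χ ∘ lookup S)
∣S∣≡∑ []          = refl
∣S∣≡∑ (true ∷ S)  = trans (cong suc (∣S∣≡∑ S)) (sym (∑-allFin-suc _ (χ ∘ lookup (true ∷ S))))
∣S∣≡∑ (false ∷ S) = trans (∣S∣≡∑ S) (sym (∑-allFin-suc _ (χ ∘ lookup (false ∷ S))))

∣∁S∣≡∑ : ∀ {n} (S : Subset n) → ∣ ∁ S ∣ ≡ ∑ (allFin n) (λ x → χ (not (lookup S x)))
∣∁S∣≡∑ S = trans (∣S∣≡∑ (∁ S)) (∑-cong (allFin _) (λ x → cong χ (lookup-map x not S)))

∣S∣+∣∁S∣≡n : ∀ {n} (S : Subset n) → ∣ S ∣ + ∣ ∁ S ∣ ≡ n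
∣S∣+∣∁S∣≡n S = trans (cong (∣ S ∣ +_) (∣∁p∣≡n∸∣p∣ S)) (m+[n∸m]≡n (∣p∣≤n S))

∑-allSubsets-suc : ∀ n (f : Subset (suc n) → ℕ) →
  ∑ (allSubsets (suc n)) f ≡ ∑ (allSubsets n) (f ∘ (true ∷_)) + ∑ (allSubsets n) (f ∘ (false ∷_))
∑-allSubsets-suc n f = trans (∑-++ (map (true ∷_) (allSubsets n)) _ f)
  (cong₂ _+_ (∑-map (allSubsets n) (true ∷_) f) (∑-map (allSubsets n) (false ∷_) f))

-- Adding u is a bijection from the subsets avoiding u onto those containing u.
∑-insert : ∀ {n} (u : Fin n) (h : Subset n → ℕ) →
  ∑ (allSubsets n) (λ S → χ (lookup S u) * h S) ≡
  ∑ (allSubsets n) (λ S → χ (not (lookup S u)) * h (S [ u ]≔ true))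
∑-insert {suc n} zero h = begin
  ∑ (allSubsets (suc n)) (λ S → χ (lookup S zero) * h S)
    ≡⟨ ∑-allSubsets-suc n _ ⟩
  ∑ (allSubsets n) (λ S → h (true ∷ S) + 0) + ∑ (allSubsets n) (λ S → 0)
    ≡⟨ +-comm (∑ (allSubsets n) (λ S → h (true ∷ S) + 0)) _ ⟩
  ∑ (allSubsets n) (λ S → 0) + ∑ (allSubsets n) (λ S → h (true ∷ S) + 0)
    ≡⟨ ∑-allSubsets-suc n _ ⟨
  ∑ (allSubsets (suc n)) (λ S → χ (not (lookup S zero)) * h (S [ zero ]≔ true)) ∎
  where open ≡-Reasoning
∑-insert {suc n} (suc u) h = begin
  ∑ (allSubsets (suc n)) (λ S → χ (lookup S (suc u)) * h S)
    ≡⟨ ∑-allSubsets-suc n _ ⟩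
  ∑ (allSubsets n) (λ S → χ (lookup S u) * h (true ∷ S)) +
  ∑ (allSubsets n) (λ S → χ (lookup S u) * h (false ∷ S))
    ≡⟨ cong₂ _+_ (∑-insert u (h ∘ (true ∷_))) (∑-insert u (h ∘ (false ∷_))) ⟩
  ∑ (allSubsets n) (λ S → χ (not (lookup S u)) * h (true ∷ (S [ u ]≔ true))) +
  ∑ (allSubsets n) (λ S → χ (not (lookup S u)) * h (false ∷ (S [ u ]≔ true)))
    ≡⟨ ∑-allSubsets-suc n _ ⟨
  ∑ (allSubsets (suc n)) (λ S → χ (not (lookup S (suc u))) * h (S [ suc u ]≔ true)) ∎
  where open ≡-Reasoning

all-true : ∀ {A : Set} (p : A → Bool) {x xs} → all p xs ≡ true → x ∈ xs → p x ≡ true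
all-true p {xs = y ∷ _}  all≡ (here refl) = ∧-conicalˡ (p y) _ all≡
all-true p {xs = y ∷ _}  all≡ (there x∈)  = all-true p (∧-conicalʳ (p y) _ all≡) x∈

all-false : ∀ {A : Set} (p : A → Bool) xs → all p xs ≡ false → ∃ λ x → p x ≡ false
all-false p (x ∷ xs) all≡ with p x in px
... | true  = all-false p xs all≡
... | false = x , px

all-intro : ∀ {A : Set} (p : A → Bool) xs → (∀ x → p x ≡ true) → all p xs ≡ true
all-intro p []       all-p = refl
all-intro p (x ∷ xs) all-p rewrite all-p x = all-intro p xs all-p

any-true : ∀ {A : Set} (p : A → Bool) xs → any p xs ≡ true → ∃ λ x → p x ≡ true
any-true p (x ∷ xs) any≡ with p x in px
... | true  = x , px
... | false = any-true p xs any≡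

any-false : ∀ {A : Set} (p : A → Bool) {x xs} → any p xs ≡ false → x ∈ xs → p x ≡ false
any-false p {xs = y ∷ _} any≡ (here refl) = ∨-conicalˡ (p y) _ any≡
any-false p {xs = y ∷ _} any≡ (there x∈)  = any-false p (∨-conicalʳ (p y) _ any≡) x∈

δ : ∀ {n} → Fin n → Fin n → ℕ
δ x y = χ (does (x ≟ y))

δ-refl : ∀ {n} (x : Fin n) → δ x x ≡ 1
δ-refl x = cong χ (dec-true (x ≟ x) refl)

δ-≢ : ∀ {n} {x y : Fin n} → x ≢ y → δ x y ≡ 0
δ-≢ {x = x} {y} x≢y = cong χ (dec-false (x ≟ y) x≢y)

∑δ-absent : ∀ {n} {y : Fin n} xs → All (y ≢_) xs → ∑ xs (λ x → δ x y) ≡ 0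
∑δ-absent []       []            = refl
∑δ-absent (x ∷ xs) (y≢x ∷ y∉xs) = cong₂ _+_ (δ-≢ (y≢x ∘ sym)) (∑δ-absent xs y∉xs)

∑δ-unique : ∀ {n} (y : Fin n) {xs} → Unique xs → ∑ xs (λ x → δ x y) ≤ 1
∑δ-unique y []                          = z≤n
∑δ-unique y {x ∷ xs} (x∉xs ∷ unique-xs) with x ≟ y
... | yes refl = s≤s (≤-reflexive (∑δ-absent xs x∉xs))
... | no _     = ∑δ-unique y unique-xs

ends : ∀ {n} → Fin n → Fin n × Fin n → ℕ
ends y (u , v) = δ u y + δ v y

ends-swap : ∀ {n} (y u v : Fin n) → ends y (u , v) ≡ ends y (v , u)
ends-swap y u v = +-comm (δ u y) _

∑-ends≤1 : ∀ {n} (y : Fin n) (M : List (Fin n × Fin n)) → Unique (endpoints M) → ∑ M (ends y) ≤ 1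
∑-ends≤1 y M unique = ≤-trans (≤-reflexive (sym (∑-endpoints M))) (∑δ-unique y unique)
  where
  ∑-endpoints : ∀ M → ∑ (endpoints M) (λ x → δ x y) ≡ ∑ M (ends y)
  ∑-endpoints []            = refl
  ∑-endpoints ((u , v) ∷ M) = trans (sym (+-assoc (δ u y) (δ v y) _)) (cong (ends y (u , v) +_) (∑-endpoints M))

χ-gate : ∀ b {m k} → (b ≡ true → m ≤ k) → χ b * m ≤ χ b * k
χ-gate true  m≤k = *-monoʳ-≤ 1 (m≤k refl)
χ-gate false m≤k = z≤n

χ*≤ : ∀ b k → χ b * k ≤ k
χ*≤ true  k = ≤-reflexive (+-identityʳ k)
χ*≤ false k = z≤n

does⇒ : ∀ {P : Set} (p? : Dec P) → does p? ≡ true → P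
does⇒ (yes p) _ = p

module Domination {n : ℕ} (G : Graph n) where

  dominating : Subset n → Bool
  dominating = isDominating G

  adj-irreflexive : ∀ {u v} → adj G u v ≡ true → u ≢ v
  adj-irreflexive {u} auv refl with () ← trans (sym auv) (irrefl G u)

  adj-sym : ∀ {u v} → adj G u v ≡ true → adj G v u ≡ true
  adj-sym {u} {v} auv = trans (Graph.sym G v u) auv

  dominated : ∀ {S x} → dominating S ≡ true → lookup S x ≡ false →
    ∃ λ z → lookup S z ≡ true × adj G z x ≡ true
  dominated {S} {x} dom Sx with all-true _ dom (∈-allFin x)
  ... | x-dominated rewrite Sx with any-true (λ u → lookup S u ∧ adj G u x) (allFin n) x-dominated
  ...   | z , Sz∧azx = z , ∧-conicalˡ _ _ Sz∧azx , ∧-conicalʳ _ _ Sz∧azx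

  undominated : ∀ {S} → dominating S ≡ false →
    ∃ λ x → lookup S x ≡ false × (∀ z → lookup S z ≡ true → adj G z x ≡ false)
  undominated {S} ¬dom with all-false _ (allFin n) ¬dom
  ... | x , x-undominated = x , ∨-conicalˡ _ _ x-undominated , no-neighbour
    where
    no-neighbour : ∀ z → lookup S z ≡ true → adj G z x ≡ false
    no-neighbour z Sz with any-false (λ u → lookup S u ∧ adj G u x) (∨-conicalʳ _ _ x-undominated) (∈-allFin z)
    ... | Sz∧azx rewrite Sz = Sz∧azx

  privateNbr : Subset n → Fin n → Fin n → Bool
  privateNbr S y x =
    not (lookup S x) ∧ (lookup S y ∧ adj G y x) ∧
    all (λ z → not (lookup S z ∧ adj G z x) ∨ does (z ≟ y)) (allFin n)

  record IsPrivateNbr (S : Subset n) (y x : Fin n) : Set where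
    field
      outside  : lookup S x ≡ false
      inside   : lookup S y ≡ true
      adjacent : adj G y x ≡ true
      unique   : ∀ z → lookup S z ≡ true → adj G z x ≡ true → z ≡ y

  privateNbr-sound : ∀ S {y x} → privateNbr S y x ≡ true → IsPrivateNbr S y x
  privateNbr-sound S {y} {x} priv
    with lookup S x in Sx | lookup S y in Sy | adj G y x in ayx
  ... | false | true | true = record
    { outside = Sx ; inside = Sy ; adjacent = ayx ; unique = unique }
    where
    unique : ∀ z → lookup S z ≡ true → adj G z x ≡ true → z ≡ y
    unique z Sz azx
      with all-true (λ z → not (lookup S z ∧ adj G z x) ∨ does (z ≟ y)) priv (∈-allFin z)
    ... | z-only rewrite Sz | azx = does⇒ (z ≟ y) z-only

  privateNbr-complete : ∀ {S y x} → IsPrivateNbr S y x → privateNbr S y x ≡ true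
  privateNbr-complete {S} {y} {x} p
    rewrite IsPrivateNbr.outside p | IsPrivateNbr.inside p | IsPrivateNbr.adjacent p =
    all-intro _ (allFin n) only-y
    where
    only-y : ∀ z → not (lookup S z ∧ adj G z x) ∨ does (z ≟ y) ≡ true
    only-y z with lookup S z ∧ adj G z x in Sz∧azx
    ... | false = refl
    ... | true  = dec-true (z ≟ y)
      (IsPrivateNbr.unique p z (∧-conicalˡ _ _ Sz∧azx) (∧-conicalʳ _ _ Sz∧azx))

  -- Key lemma: if S dominates and u has a neighbour v ∈ S, then S − u still
  -- dominates, or u has a private neighbour (a vertex x that only u dominates;
  -- x ≠ u because v dominates u).
  removable-or-private : ∀ {S u v} → dominating S ≡ true → lookup S v ≡ true → adj G u v ≡ true →
    dominating (S [ u ]≔ false) ≡ true ⊎ ∃ (IsPrivateNbr S u)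
  removable-or-private {S} {u} {v} dom Sv auv with dominating (S [ u ]≔ false) in dom-u
  ... | true  = inj₁ refl
  ... | false with undominated {S [ u ]≔ false} dom-u
  ...   | x , S-u∌x , no-neighbour = inj₂ (x , record
            { outside = outside ; inside = proj₁ u-dominates-x ; adjacent = proj₂ u-dominates-x
            ; unique = unique })
    where
    kept : ∀ {w} → w ≢ u → lookup (S [ u ]≔ false) w ≡ lookup S w
    kept w≢u = lookup∘update′ w≢u S false

    unique : ∀ z → lookup S z ≡ true → adj G z x ≡ true → z ≡ u
    unique z Sz azx with z ≟ u
    ... | yes z≡u = z≡u
    ... | no  z≢u with () ← trans (sym azx) (no-neighbour z (trans (kept z≢u) Sz))

    x≢u : x ≢ u
    x≢u refl = adj-irreflexive auv (sym (unique v Sv (adj-sym auv)))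

    outside : lookup S x ≡ false
    outside = trans (sym (kept x≢u)) S-u∌x

    u-dominates-x : lookup S u ≡ true × adj G u x ≡ true
    u-dominates-x with dominated {S} dom outside
    ... | z , Sz , azx with unique z Sz azx
    ...   | refl = Sz , azx

  privateCount : Subset n → Fin n → ℕ
  privateCount S y = ∑ (allFin n) (λ x → χ (privateNbr S y x))

  privateNbr⇒count : ∀ {S y x} → IsPrivateNbr S y x → 1 ≤ privateCount S y
  privateNbr⇒count {S} {y} {x} p =
    subst (λ b → χ b ≤ privateCount S y) (privateNbr-complete p)
      (∈⇒≤∑ (λ x → χ (privateNbr S y x)) (∈-allFin x))

  record Anchor (S : Subset n) (x a : Fin n) : Set where
    field
      owns-private : ∀ y → privateNbr S y x ≡ true → y ≡ a
      covers-nbrs  : a ≡ x ⊎ (∀ z → lookup S z ≡ true → adj G z x ≡ true → z ≡ a)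

  -- Every vertex has an anchor: its private owner if there is one, else itself.
  anchor : ∀ S x → ∃ (Anchor S x)
  anchor S x with any? (λ y → privateNbr S y x Bool.≟ true)
  ... | yes (w , w-private) = w , record
    { owns-private = λ y y-private → let p = privateNbr-sound S y-private in
        IsPrivateNbr.unique w-nbr y (IsPrivateNbr.inside p) (IsPrivateNbr.adjacent p)
    ; covers-nbrs  = inj₂ (IsPrivateNbr.unique w-nbr) }
    where w-nbr = privateNbr-sound S w-private
  ... | no none = x , record
    { owns-private = λ y y-private → ⊥-elim (none (y , y-private))
    ; covers-nbrs  = inj₁ refl }

  endShare : Subset n → Fin n → Fin n → Fin n → ℕ
  endShare S u v x = δ u x * (χ (not (lookup S x)) * (1 + 2 * χ (lookup S v)))

  share : Subset n → Fin n × Fin n → Fin n → ℕ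
  share S (u , v) x =
    endShare S u v x + endShare S v u x +
    χ (lookup S u ∧ lookup S v) * (χ (privateNbr S u x) + χ (privateNbr S v x))

  endShare-self : ∀ S u v → endShare S u v u ≡ χ (not (lookup S u)) * (1 + 2 * χ (lookup S v))
  endShare-self S u v rewrite δ-refl u = +-identityʳ _

  endShare-other : ∀ S {u} v {x} → u ≢ x → endShare S u v x ≡ 0
  endShare-other S v u≢x rewrite δ-≢ u≢x = refl

  share-swap : ∀ S (u v x : Fin n) → share S (u , v) x ≡ share S (v , u) x
  share-swap S u v x = cong₂ _+_ (+-comm (endShare S u v x) _)
    (cong₂ _*_ (cong χ (∧-comm (lookup S u) _)) (+-comm (χ (privateNbr S u x)) _))

  share-inside : ∀ S {x} e → lookup S x ≡ true → share S e x ≡ 0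
  share-inside S {x} (u , v) Sx rewrite Sx | *-zeroʳ (δ u x) | *-zeroʳ (δ v x) =
    *-zeroʳ (χ (lookup S u ∧ lookup S v))

  -- A missing endpoint x carries ≤ 3 units of its own edge xv; 3 only when v ∈ S,
  -- and then v is the anchor of x or x is its own anchor.
  endpoint-share : ∀ {S x a v} → lookup S x ≡ false → Anchor S x a → adj G x v ≡ true →
    share S (x , v) x ≤ 2 * ends x (x , v) + ends a (x , v)
  endpoint-share {S} {x} {a} {v} Sx anc axv = begin
    share S (x , v) x                   ≡⟨ share≡ ⟩
    1 + 2 * χ (lookup S v)              ≤⟨ partner-bound (lookup S v) refl ⟩
    2 + ends a (x , v)                  ≡⟨ cong (λ k → 2 * k + ends a (x , v)) ends-self ⟨
    2 * ends x (x , v) + ends a (x , v) ∎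
    where
    open ≤-Reasoning
    v≢x : v ≢ x
    v≢x v≡x = adj-irreflexive axv (sym v≡x)

    ends-self : ends x (x , v) ≡ 1
    ends-self = cong₂ _+_ (δ-refl x) (δ-≢ v≢x)

    share≡ : share S (x , v) x ≡ 1 + 2 * χ (lookup S v)
    share≡ rewrite endShare-self S x v | endShare-other S x v≢x | Sx =
      trans (+-identityʳ _) (trans (+-identityʳ _) (*-identityˡ _))

    partner-bound : ∀ b → lookup S v ≡ b → 1 + 2 * χ b ≤ 2 + ends a (x , v)
    partner-bound false _ = m≤m+n 1 _
    partner-bound true Sv with Anchor.covers-nbrs anc
    ... | inj₁ refl = +-monoʳ-≤ 2 (≤-trans (≤-reflexive (sym (δ-refl a))) (m≤m+n _ _))
    ... | inj₂ nbr≡a with nbr≡a v Sv (adj-sym axv)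
    ...   | refl = +-monoʳ-≤ 2 (≤-trans (≤-reflexive (sym (δ-refl v))) (m≤n+m _ _))

  -- A vertex off the edge carries only private-neighbour units, all owned by the anchor.
  interior-share : ∀ {S x a u v} → Anchor S x a → u ≢ x → v ≢ x →
    share S (u , v) x ≤ ends a (u , v)
  interior-share {S} {x} {a} {u} {v} anc u≢x v≢x
    rewrite endShare-other S v u≢x | endShare-other S u v≢x = begin
    χ (lookup S u ∧ lookup S v) * (χ (privateNbr S u x) + χ (privateNbr S v x))
      ≤⟨ χ*≤ (lookup S u ∧ lookup S v) _ ⟩
    χ (privateNbr S u x) + χ (privateNbr S v x)
      ≤⟨ +-mono-≤ (owned u) (owned v) ⟩
    δ u a + δ v a ∎
    where
    open ≤-Reasoning
    owned : ∀ y → χ (privateNbr S y x) ≤ δ y a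
    owned y with privateNbr S y x in y-private
    ... | false = z≤n
    ... | true with Anchor.owns-private anc y y-private
    ...   | refl = ≤-reflexive (sym (δ-refl y))

  share-bound : ∀ {S x a} e → lookup S x ≡ false → Anchor S x a → adj G (proj₁ e) (proj₂ e) ≡ true →
    share S e x ≤ 2 * ends x e + ends a e
  share-bound {S} {x} {a} (u , v) Sx anc auv = by-position (u ≟ x) (v ≟ x)
    where
    by-position : Dec (u ≡ x) → Dec (v ≡ x) → share S (u , v) x ≤ 2 * ends x (u , v) + ends a (u , v)
    by-position (yes refl) (yes v≡x) = ⊥-elim (adj-irreflexive auv (sym v≡x))
    by-position (yes refl) (no _)    = endpoint-share Sx anc auv
    by-position (no _)     (yes refl) = subst₂ _≤_ (sym (share-swap S u x x))
      (sym (cong₂ (λ p q → 2 * p + q) (ends-swap x u x) (ends-swap a u x)))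
      (endpoint-share {S} {x} {a} {u} Sx anc (adj-sym auv))
    by-position (no u≢x)   (no v≢x)   =
      ≤-trans (interior-share anc u≢x v≢x) (m≤n+m (ends a (u , v)) (2 * ends x (u , v)))

  charge : Subset n → Fin n × Fin n → ℕ
  charge S (u , v) =
    χ (not (lookup S u)) * (1 + 2 * χ (lookup S v)) +
    χ (not (lookup S v)) * (1 + 2 * χ (lookup S u)) +
    χ (lookup S u ∧ lookup S v) * (privateCount S u + privateCount S v)

  charge≤∑share : ∀ S e → charge S e ≤ ∑ (allFin n) (share S e)
  charge≤∑share S (u , v) = begin
    charge S (u , v)
      ≤⟨ +-mono-≤ (+-mono-≤ (endShare-mass u v) (endShare-mass v u)) (≤-reflexive private-mass) ⟩
    ∑ (allFin n) (endShare S u v) + ∑ (allFin n) (endShare S v u) + ∑ (allFin n) privateShare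
      ≡⟨ cong (_+ ∑ (allFin n) privateShare) (∑-+ (allFin n) (endShare S u v) (endShare S v u)) ⟨
    ∑ (allFin n) (λ x → endShare S u v x + endShare S v u x) + ∑ (allFin n) privateShare
      ≡⟨ ∑-+ (allFin n) _ privateShare ⟨
    ∑ (allFin n) (share S (u , v)) ∎
    where
    open ≤-Reasoning
    privateShare : Fin n → ℕ
    privateShare x = χ (lookup S u ∧ lookup S v) * (χ (privateNbr S u x) + χ (privateNbr S v x))

    endShare-mass : ∀ u v → χ (not (lookup S u)) * (1 + 2 * χ (lookup S v)) ≤ ∑ (allFin n) (endShare S u v)
    endShare-mass u v = subst (_≤ ∑ (allFin n) (endShare S u v)) (endShare-self S u v)
      (∈⇒≤∑ (endShare S u v) (∈-allFin u))

    private-mass : χ (lookup S u ∧ lookup S v) * (privateCount S u + privateCount S v) ≡ ∑ (allFin n) privateShare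
    private-mass = sym (trans (∑-*ˡ (allFin n) (χ (lookup S u ∧ lookup S v)) private-u+v)
      (cong (χ (lookup S u ∧ lookup S v) *_) (∑-+ (allFin n) (private-of u) (private-of v))))
      where
      private-of : Fin n → Fin n → ℕ
      private-of y x = χ (privateNbr S y x)
      private-u+v : Fin n → ℕ
      private-u+v x = private-of u x + private-of v x

  vertex-load : ∀ {M} → IsMatching G M → ∀ S x → ∑ M (λ e → share S e x) ≤ 3 * χ (not (lookup S x))
  vertex-load {M} (adjacent-M , unique-M) S x = by-membership (lookup S x) refl
    where
    open ≤-Reasoning
    by-membership : ∀ b → lookup S x ≡ b → ∑ M (λ e → share S e x) ≤ 3 * χ (not b)
    by-membership true Sx = ≤-reflexive (trans (∑-cong M (λ e → share-inside S e Sx)) (∑-const M 0))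
    by-membership false Sx with anchor S x
    ... | a , anc = begin
      ∑ M (λ e → share S e x)                 ≤⟨ ∑-mono-All adjacent-M (λ e → share-bound e Sx anc) ⟩
      ∑ M (λ e → 2 * ends x e + ends a e)     ≡⟨ ∑-+ M _ (ends a) ⟩
      ∑ M (λ e → 2 * ends x e) + ∑ M (ends a) ≡⟨ cong (_+ ∑ M (ends a)) (∑-*ˡ M 2 (ends x)) ⟩
      2 * ∑ M (ends x) + ∑ M (ends a)         ≤⟨ +-mono-≤ (*-monoʳ-≤ 2 (∑-ends≤1 x M unique-M))
                                                          (∑-ends≤1 a M unique-M) ⟩
      3                                       ∎

  charging : ∀ {M} → IsMatching G M → ∀ S → ∑ M (charge S) ≤ 3 * ∣ ∁ S ∣
  charging {M} matching S = begin
    ∑ M (charge S)                                 ≤⟨ ∑-mono M (charge≤∑share S) ⟩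
    ∑ M (λ e → ∑ (allFin n) (share S e))           ≡⟨ ∑-comm M (allFin n) (share S) ⟩
    ∑ (allFin n) (λ x → ∑ M (λ e → share S e x))   ≤⟨ ∑-mono (allFin n) (vertex-load matching S) ⟩
    ∑ (allFin n) (λ x → 3 * χ (not (lookup S x)))  ≡⟨ ∑-*ˡ (allFin n) 3 _ ⟩
    3 * ∑ (allFin n) (λ x → χ (not (lookup S x)))  ≡⟨ cong (3 *_) (∣∁S∣≡∑ S) ⟨
    3 * ∣ ∁ S ∣                                    ∎
    where open ≤-Reasoning

  demand : Subset n → Fin n × Fin n → ℕ
  demand S (u , v) =
    2 * χ (not (lookup S u ∧ lookup S v)) +
    χ (lookup S u ∧ lookup S v) * (privateCount S u + privateCount S v)

  removable : Subset n → Fin n → Fin n → Bool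
  removable S u v = (lookup S u ∧ lookup S v) ∧ dominating (S [ u ]≔ false)

  missing-partner : Subset n → Fin n → Fin n → ℕ
  missing-partner S u v = χ (not (lookup S u) ∧ lookup S v)

  removable-or-private-count : ∀ {S u v} → dominating S ≡ true → lookup S v ≡ true → adj G u v ≡ true →
    1 ≤ χ (dominating (S [ u ]≔ false)) + privateCount S u
  removable-or-private-count {S} {u} dom Sv auv with removable-or-private {S} dom Sv auv
  ... | inj₁ dom-u rewrite dom-u = s≤s z≤n
  ... | inj₂ (_ , p)             = ≤-trans (privateNbr⇒count p) (m≤n+m _ _)

  demand-met : ∀ S {u v} → dominating S ≡ true → adj G u v ≡ true →
    2 ≤ demand S (u , v) + χ (removable S u v) + χ (removable S v u)
  demand-met S {u} {v} dom auv = by-membership (lookup S u) (lookup S v) refl refl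
    where
    both-inside : ∀ p q r s → 1 ≤ χ r + p → 1 ≤ χ s + q → 2 ≤ 1 * (p + q) + χ (true ∧ r) + χ (true ∧ s)
    both-inside p q r s 1≤r+p 1≤s+q = ≤-trans (+-mono-≤ 1≤r+p 1≤s+q) (≤-reflexive (rearrange p q (χ r) (χ s)))
      where
      rearrange : ∀ p q r s → r + p + (s + q) ≡ 1 * (p + q) + r + s
      rearrange = solve-∀
    by-membership : ∀ su sv → lookup S u ≡ su → lookup S v ≡ sv →
      2 ≤ 2 * χ (not (su ∧ sv)) + χ (su ∧ sv) * (privateCount S u + privateCount S v)
          + χ ((su ∧ sv) ∧ dominating (S [ u ]≔ false)) + χ ((sv ∧ su) ∧ dominating (S [ v ]≔ false))
    by-membership true  true  Su Sv = both-inside (privateCount S u) (privateCount S v)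
      (dominating (S [ u ]≔ false)) (dominating (S [ v ]≔ false))
      (removable-or-private-count {S} dom Sv auv)
      (removable-or-private-count {S} dom Su (adj-sym auv))
    by-membership true  false _  _  = ≤-refl
    by-membership false true  _  _  = ≤-refl
    by-membership false false _  _  = s≤s (s≤s z≤n)
  charge≡demand+missing : ∀ S u v →
    demand S (u , v) + missing-partner S u v + missing-partner S v u ≡ charge S (u , v)
  charge≡demand+missing S u v = by-membership (lookup S u) (lookup S v)
    (privateCount S u + privateCount S v)
    where
    by-membership : ∀ su sv k →
      2 * χ (not (su ∧ sv)) + χ (su ∧ sv) * k + χ (not su ∧ sv) + χ (not sv ∧ su) ≡
      χ (not su) * (1 + 2 * χ sv) + χ (not sv) * (1 + 2 * χ su) + χ (su ∧ sv) * k
    by-membership true  true  k = trans (+-identityʳ _) (+-identityʳ _)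
    by-membership true  false k = refl
    by-membership false true  k = refl
    by-membership false false k = refl

  weight : Subset n → ℕ
  weight S = χ (dominating S)

  -- Step (2): via S ↦ S − u, the sets from which u is removable are counted by the
  -- dominating sets missing u but containing v.
  removable-injection : ∀ {u v} → v ≢ u →
    ∑ (allSubsets n) (λ S → weight S * χ (removable S u v)) ≤
    ∑ (allSubsets n) (λ S → weight S * missing-partner S u v)
  removable-injection {u} {v} v≢u = begin
    ∑ (allSubsets n) (λ S → weight S * χ (removable S u v))
      ≡⟨ ∑-cong (allSubsets n) (λ S → χ-pull (dominating S) (lookup S u) (lookup S v) _) ⟩
    ∑ (allSubsets n) (λ S → χ (lookup S u) * h S)
      ≡⟨ ∑-insert u h ⟩
    ∑ (allSubsets n) (λ S → χ (not (lookup S u)) * h (S [ u ]≔ true))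
      ≤⟨ ∑-mono (allSubsets n) (λ S → reinsert S (lookup S u) refl) ⟩
    ∑ (allSubsets n) (λ S → weight S * missing-partner S u v) ∎
    where
    open ≤-Reasoning
    h : Subset n → ℕ
    h S = weight S * χ (lookup S v ∧ dominating (S [ u ]≔ false))

    χ-pull : ∀ d a b c → χ d * χ ((a ∧ b) ∧ c) ≡ χ a * (χ d * χ (b ∧ c))
    χ-pull d true  b c = sym (+-identityʳ _)
    χ-pull d false b c = *-zeroʳ (χ d)

    χ-drop : ∀ a b c → χ a * χ (b ∧ c) ≤ χ c * χ b
    χ-drop false b     c     = z≤n
    χ-drop true  false c     = z≤n
    χ-drop true  true  false = z≤n
    χ-drop true  true  true  = ≤-refl

    reinsert : ∀ S b → lookup S u ≡ b →
      χ (not b) * h (S [ u ]≔ true) ≤ weight S * χ (not b ∧ lookup S v)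
    reinsert S true  Su = z≤n
    reinsert S false Su = begin
      1 * h (S [ u ]≔ true)
        ≡⟨ *-identityˡ _ ⟩
      weight (S [ u ]≔ true) * χ (lookup (S [ u ]≔ true) v ∧ dominating ((S [ u ]≔ true) [ u ]≔ false))
        ≡⟨ cong₂ (λ b T → weight (S [ u ]≔ true) * χ (b ∧ dominating T))
                 (lookup∘update′ v≢u S true) restore ⟩
      weight (S [ u ]≔ true) * χ (lookup S v ∧ dominating S)
        ≤⟨ χ-drop (dominating (S [ u ]≔ true)) (lookup S v) (dominating S) ⟩
      weight S * χ (lookup S v) ∎
      where
      restore : (S [ u ]≔ true) [ u ]≔ false ≡ S
      restore = trans ([]≔-idempotent S u) (trans (cong (S [ u ]≔_) (sym Su)) ([]≔-lookup S u))

  edge-bound : ∀ {u v} → adj G u v ≡ true →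
    ∑ (allSubsets n) (λ S → weight S * 2) ≤ ∑ (allSubsets n) (λ S → weight S * charge S (u , v))
  edge-bound {u} {v} auv = begin
    ∑ 𝒜 (λ S → weight S * 2)
      ≤⟨ ∑-mono 𝒜 (λ S → χ-gate (dominating S) (λ dom → demand-met S dom auv)) ⟩
    ∑ 𝒜 (λ S → weight S * (demand S (u , v) + χ (removable S u v) + χ (removable S v u)))
      ≡⟨ ∑-weighted-+3 𝒜 weight _ _ _ ⟩
    ∑ 𝒜 (λ S → weight S * demand S (u , v)) + ∑ 𝒜 (λ S → weight S * χ (removable S u v)) +
    ∑ 𝒜 (λ S → weight S * χ (removable S v u))
      ≤⟨ +-mono-≤ (+-monoʳ-≤ _ (removable-injection v≢u)) (removable-injection (v≢u ∘ sym)) ⟩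
    ∑ 𝒜 (λ S → weight S * demand S (u , v)) + ∑ 𝒜 (λ S → weight S * missing-partner S u v) +
    ∑ 𝒜 (λ S → weight S * missing-partner S v u)
      ≡⟨ ∑-weighted-+3 𝒜 weight _ _ _ ⟨
    ∑ 𝒜 (λ S → weight S * (demand S (u , v) + missing-partner S u v + missing-partner S v u))
      ≡⟨ ∑-cong 𝒜 (λ S → cong (weight S *_) (charge≡demand+missing S u v)) ⟩
    ∑ 𝒜 (λ S → weight S * charge S (u , v)) ∎
    where
    open ≤-Reasoning
    𝒜 = allSubsets n
    v≢u : v ≢ u
    v≢u v≡u = adj-irreflexive auv (sym v≡u)

  matching-bound : ∀ {M} → IsMatching G M →
    ∑ (dominatingSets G) (λ _ → ∑ M (λ _ → 2)) ≤ 3 * ∑ (dominatingSets G) (λ S → ∣ ∁ S ∣)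
  matching-bound {M} matching@(adjacent-M , _) = begin
    ∑ (dominatingSets G) (λ _ → ∑ M (λ _ → 2))      ≡⟨ ∑-filter 𝒜 dominating _ ⟩
    ∑ 𝒜 (λ S → weight S * ∑ M (λ _ → 2))           ≡⟨ ∑-cong 𝒜 (λ S → ∑-*ˡ M (weight S) (λ _ → 2)) ⟨
    ∑ 𝒜 (λ S → ∑ M (λ _ → weight S * 2))           ≡⟨ ∑-comm 𝒜 M _ ⟩
    ∑ M (λ e → ∑ 𝒜 (λ S → weight S * 2))           ≤⟨ ∑-mono-All adjacent-M (λ e → edge-bound) ⟩
    ∑ M (λ e → ∑ 𝒜 (λ S → weight S * charge S e))  ≡⟨ ∑-comm M 𝒜 _ ⟩
    ∑ 𝒜 (λ S → ∑ M (λ e → weight S * charge S e))  ≡⟨ ∑-cong 𝒜 (λ S → ∑-*ˡ M (weight S) (charge S)) ⟩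
    ∑ 𝒜 (λ S → weight S * ∑ M (charge S))          ≤⟨ ∑-mono 𝒜 (λ S → *-monoʳ-≤ (weight S) (charging matching S)) ⟩
    ∑ 𝒜 (λ S → weight S * (3 * ∣ ∁ S ∣))           ≡⟨ ∑-cong 𝒜 (λ S → *-left-comm (weight S) 3 ∣ ∁ S ∣) ⟩
    ∑ 𝒜 (λ S → 3 * (weight S * ∣ ∁ S ∣))           ≡⟨ ∑-*ˡ 𝒜 3 _ ⟩
    3 * ∑ 𝒜 (λ S → weight S * ∣ ∁ S ∣)             ≡⟨ cong (3 *_) (∑-filter 𝒜 dominating _) ⟨
    3 * ∑ (dominatingSets G) (λ S → ∣ ∁ S ∣)        ∎
    where
    open ≤-Reasoning
    𝒜 = allSubsets n

theorem5p1 : (n : ℕ) (G : Graph n) (ν : ℕ) → IsMatchingNumber G ν →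
    3 * totalDomSize G + 2 * ν * numDom G ≤ 3 * n * numDom G
theorem5p1 n G ν ((M , matching , |M|≡ν) , _) = begin
  3 * totalDomSize G + 2 * ν * numDom G            ≡⟨ cong (3 * totalDomSize G +_) twice-ν ⟩
  3 * ∑ 𝒟 ∣_∣ + ∑ 𝒟 (λ _ → ∑ M (λ _ → 2))          ≤⟨ +-monoʳ-≤ (3 * ∑ 𝒟 ∣_∣) (matching-bound matching) ⟩
  3 * ∑ 𝒟 ∣_∣ + 3 * ∑ 𝒟 (λ S → ∣ ∁ S ∣)            ≡⟨ *-distribˡ-+ 3 (∑ 𝒟 ∣_∣) (∑ 𝒟 (λ S → ∣ ∁ S ∣)) ⟨
  3 * (∑ 𝒟 ∣_∣ + ∑ 𝒟 (λ S → ∣ ∁ S ∣))              ≡⟨ cong (3 *_) (∑-+ 𝒟 ∣_∣ (λ S → ∣ ∁ S ∣)) ⟨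
  3 * ∑ 𝒟 (λ S → ∣ S ∣ + ∣ ∁ S ∣)                  ≡⟨ cong (3 *_) (∑-cong 𝒟 ∣S∣+∣∁S∣≡n) ⟩
  3 * ∑ 𝒟 (λ _ → n)                               ≡⟨ cong (3 *_) (∑-const 𝒟 n) ⟩
  3 * (n * numDom G)                              ≡⟨ *-assoc 3 n (numDom G) ⟨
  3 * n * numDom G                                ∎
  where
  open ≤-Reasoning
  open Domination G
  𝒟 = dominatingSets G
  twice-ν : 2 * ν * numDom G ≡ ∑ 𝒟 (λ _ → ∑ M (λ _ → 2))
  twice-ν = sym (trans (∑-const 𝒟 (∑ M (λ _ → 2)))
                       (cong (_* numDom G) (trans (∑-const M 2) (cong (2 *_) |M|≡ν))))
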